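{- Define polynomials $G_r(y)$ by $G_0=0$, $G_1=1$, and for $r\ge2$ \[ G_r=1+y+y\sum_{i=2}^{r-1}(G_i-G_{i-1})\,G_{r+1-i}. \] Then for all $r\ge 2$, $G_r$ has degree $2r-3$ and leading coefficient the $(r-2)$th Catalan number $\mathrm{cat}(r-2)=\frac{1}{r-1}\binom{2r-4}{r-2}$. -}

module Defs where

open import Data.Nat as ℕ using (ℕ; zero; suc; _∸_; _≤_; _<_)
open import Data.Nat.Combinatorics using (_C_)
open import Data.Nat.DivMod using (_/_)
open import Data.Integer as ℤ using (ℤ; +_)
open import Data.Fin using (Fin; fromℕ; toℕ; inject₁; fromℕ<)
open import Data.Fin.Properties using ()
open import Data.Nat.Properties using (≤-refl)
open import Data.List using (List; []; _∷_; upTo; map; sum)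
open import Data.List as L using ()
open import Relation.Nullary using (yes; no)
open import Relation.Binary.PropositionalEquality using (_≡_; _≢_)
open import Data.Product using (_×_)

-- Polynomials in y with integer coefficients, as coefficient functions:
-- p n is the coefficient of y^n.  (Only finitely supported ones arise here.)
Poly : Set
Poly = ℕ → ℤ

0ₚ 1ₚ yₚ : Poly
0ₚ _ = + 0
1ₚ zero = + 1
1ₚ (suc _) = + 0
yₚ (suc zero) = + 1
yₚ _ = + 0

_+ₚ_ _-ₚ_ _*ₚ_ : Poly → Poly → Poly
(p +ₚ q) n = p n ℤ.+ q n
(p -ₚ q) n = p n ℤ.- q n
(p *ₚ q) n = L.foldr ℤ._+_ (+ 0) (map (λ k → p k ℤ.* q (n ∸ k)) (upTo (suc n)))

infixl 6 _+ₚ_ _-ₚ_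
infixl 7 _*ₚ_

-- Σ_{i=a}^{b} f i  (empty if b < a), summing polynomials
Σₚ : ℕ → ℕ → (ℕ → Poly) → Poly
Σₚ a b f = L.foldr _+ₚ_ 0ₚ (map (λ k → f (a ℕ.+ k)) (upTo (suc b ∸ a)))

-- Course-of-values table: Gtab r i = G_i for all i ≤ r (indices > r give 0ₚ).
-- G_0 = 0, G_1 = 1, and for r ≥ 2:
--   G_r = 1 + y + y * Σ_{i=2}^{r-1} (G_i - G_{i-1}) * G_{r+1-i}
Gtab : ℕ → ℕ → Poly
Gtab zero i = 0ₚ
Gtab (suc r) i with i ℕ.≟ suc r
... | no _ = Gtab r i
... | yes _ = step r
  where
  -- new entry G_{r+1}, using earlier ones G = Gtab r
  step : ℕ → Poly
  step zero = 1ₚ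
  step (suc r') =  -- G_{r'+2}, with R = r'+2
    1ₚ +ₚ yₚ +ₚ yₚ *ₚ Σₚ 2 (suc r')
      (λ i → (Gtab (suc r') i -ₚ Gtab (suc r') (i ∸ 1)) *ₚ Gtab (suc r') (suc (suc r') ℕ.+ 1 ∸ i))

G : ℕ → Poly
G r = Gtab r r

cat : ℕ → ℕ
cat n = ((2 ℕ.* n) C n) / suc n

HasDegreeLead : Poly → ℕ → ℤ → Set
HasDegreeLead p d c = (c ≢ + 0) × (p d ≡ c) × (∀ n → d < n → p n ≡ + 0)

-- Write r = j + 2.  By strong induction on j, G_{j+2} has degree at most 2j + 1 with coefficient
-- c_j there, where c_0 = 1 and c_{n+1} = Σ_{k ≤ n} c_k c_{n-k}: in the recurrence for G_{n+3} the
-- factor G_{k+2} - G_{k+1} keeps the top term of G_{k+2}, since G_{k+1} has lower degree, so the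
-- k-th summand has degree 2n + 2 and top coefficient c_k c_{n-k}, and the factor y lifts this to
-- 2n + 3.  The c_j are the ballot numbers b(1, j): their convolution identity is the decomposition
-- of a lattice path at its first visit to a lower height, and the reflection principle, proved
-- from Pascal's rule, gives b(1, n) = C(2n, n)/(n + 1) = cat(n), which is nonzero.
{-# OPTIONS --safe #-}
module Submission where

import Algebra.Properties.CommutativeSemigroup as CommSemigroupProperties
open import Data.Integer as ℤ using (ℤ; +_)
import Data.Integer.Properties as ℤP
open import Data.List using (List; []; _∷_; _∷ʳ_; map; foldr; upTo; applyUpTo)
open import Data.List.Properties
  using (map-cong; map-cong-local; map-∘; map-++; map-upTo; upTo-∷ʳ; foldr-preservesᵇ)
open import Data.List.Relation.Unary.All using (All; []; _∷_)
open import Data.List.Relation.Unary.All.Properties using (applyUpTo⁺₁; applyUpTo⁺₂; map⁺)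
open import Data.Nat as ℕ using (ℕ; zero; suc; _+_; _*_; _∸_; _≤_; _<_; z≤n; s≤s)
open import Data.Nat.Combinatorics using (_C_; nCk+nC[k+1]≡[n+1]C[k+1]; nCk≡nC[n∸k]; nC1≡n)
open import Data.Nat.DivMod using (_/_; m*n/n≡m)
open import Data.Nat.Induction using (<-rec)
open import Data.Nat.ListAction using (sum)
open import Data.Nat.ListAction.Properties using (sum-++)
open import Data.Nat.Properties
open import Data.Nat.Solver using (module +-*-Solver)
open import Data.Product using (_×_; _,_)
open import Data.Sum using (_⊎_; inj₁; inj₂; map₂)
open import Function using (_∘_; id)
open import Relation.Binary.Definitions using (tri<; tri≈; tri>)
open import Relation.Binary.PropositionalEquality
open import Relation.Nullary using (contradiction; yes; no)

open import Defs

open CommSemigroupProperties +-commutativeSemigroup using (interchange; xy∙z≈xz∙y)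
open +-*-Solver using (solve; _:+_; _:*_; _:=_; con)
open ≡-Reasoning

-- Ballot and Catalan numbers

-- ballot m n counts lattice paths from height m with n up-steps that first reach height 0 at their end.
ballot : ℕ → ℕ → ℕ
ballot m       zero    = 1
ballot zero    (suc n) = 0
ballot (suc m) (suc n) = ballot m (suc n) + ballot (suc (suc m)) n

ballot-suc-positive : ∀ m n → 0 < ballot (suc m) n
ballot-suc-positive m zero    = s≤s z≤n
ballot-suc-positive m (suc n) = ≤-trans (ballot-suc-positive (suc m) n) (m≤n+m _ _)

infixl 7 _⋆_

_⋆_ : (ℕ → ℕ) → (ℕ → ℕ) → ℕ → ℕ
(f ⋆ g) n = sum (map (λ k → f k * g (n ∸ k)) (upTo (suc n)))

sum-map-+ : ∀ {A : Set} (u v : A → ℕ) xs →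
            sum (map (λ x → u x + v x) xs) ≡ sum (map u xs) + sum (map v xs)
sum-map-+ u v []       = refl
sum-map-+ u v (x ∷ xs) =
  trans (cong (_+_ (u x + v x)) (sum-map-+ u v xs)) (interchange (u x) (v x) _ _)

⋆-distribˡ-+ : ∀ f g h n → (f ⋆ (λ k → g k + h k)) n ≡ (f ⋆ g) n + (f ⋆ h) n
⋆-distribˡ-+ f g h n = trans
  (cong sum (map-cong (λ k → *-distribˡ-+ (f k) (g (n ∸ k)) (h (n ∸ k))) (upTo (suc n))))
  (sum-map-+ (λ k → f k * g (n ∸ k)) (λ k → f k * h (n ∸ k)) (upTo (suc n)))

⋆-zeroʳ : ∀ f n → (f ⋆ (λ _ → 0)) n ≡ 0
⋆-zeroʳ f n = foldr-preservesᵇ {P = _≡ 0} {f = _+_} (λ { refl refl → refl }) refl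
  (map⁺ (applyUpTo⁺₂ id (suc n) (λ k → *-zeroʳ (f k))))

⋆-sucʳ : ∀ f g n → (f ⋆ g) (suc n) ≡ (f ⋆ (g ∘ suc)) n + f (suc n) * g 0
⋆-sucʳ f g n = begin
  sum (map h (upTo (suc (suc n))))
    ≡⟨ cong (sum ∘ map h) (upTo-∷ʳ (suc n)) ⟨
  sum (map h (upTo (suc n) ∷ʳ suc n))
    ≡⟨ cong sum (map-++ h (upTo (suc n)) _) ⟩
  sum (map h (upTo (suc n)) ∷ʳ h (suc n))
    ≡⟨ sum-++ (map h (upTo (suc n))) _ ⟩
  sum (map h (upTo (suc n))) + (h (suc n) + 0)
    ≡⟨ cong₂ _+_ (cong sum (map-cong-local (applyUpTo⁺₁ _ (suc n) shift))) last ⟩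
  (f ⋆ (g ∘ suc)) n + f (suc n) * g 0
    ∎
  where
  h : ℕ → ℕ
  h k = f k * g (suc n ∸ k)
  shift : ∀ {k} → k < suc n → h k ≡ f k * g (suc (n ∸ k))
  shift {k} (s≤s k≤n) = cong (λ i → f k * g i) (+-∸-assoc 1 k≤n)
  last : h (suc n) + 0 ≡ f (suc n) * g 0
  last = trans (+-identityʳ _) (cong (λ i → f (suc n) * g i) (n∸n≡0 n))

ballot1⋆ballot : ∀ m n → (ballot 1 ⋆ ballot m) n ≡ ballot (suc m) n
ballot1⋆ballot m       zero    = refl
ballot1⋆ballot zero    (suc n) = begin
  (ballot 1 ⋆ ballot 0) (suc n)
    ≡⟨ ⋆-sucʳ (ballot 1) (ballot 0) n ⟩
  (ballot 1 ⋆ (λ _ → 0)) n + ballot 1 (suc n) * 1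
    ≡⟨ cong₂ _+_ (⋆-zeroʳ (ballot 1) n) (*-identityʳ _) ⟩
  ballot 1 (suc n)
    ∎
ballot1⋆ballot (suc m) (suc n) = begin
  (ballot 1 ⋆ ballot (suc m)) (suc n)
    ≡⟨ ⋆-sucʳ (ballot 1) (ballot (suc m)) n ⟩
  (ballot 1 ⋆ (ballot (suc m) ∘ suc)) n + c
    ≡⟨ cong (_+ c) (⋆-distribˡ-+ (ballot 1) (ballot m ∘ suc) (ballot (suc (suc m))) n) ⟩
  (ballot 1 ⋆ (ballot m ∘ suc)) n + (ballot 1 ⋆ ballot (suc (suc m))) n + c
    ≡⟨ xy∙z≈xz∙y ((ballot 1 ⋆ (ballot m ∘ suc)) n) ((ballot 1 ⋆ ballot (suc (suc m))) n) c ⟩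
  (ballot 1 ⋆ (ballot m ∘ suc)) n + c + (ballot 1 ⋆ ballot (suc (suc m))) n
    ≡⟨ cong (_+ (ballot 1 ⋆ ballot (suc (suc m))) n) (⋆-sucʳ (ballot 1) (ballot m) n) ⟨
  (ballot 1 ⋆ ballot m) (suc n) + (ballot 1 ⋆ ballot (suc (suc m))) n
    ≡⟨ cong₂ _+_ (ballot1⋆ballot m (suc n)) (ballot1⋆ballot (suc (suc m)) n) ⟩
  ballot (suc m) (suc n) + ballot (suc (suc (suc m))) n
    ∎
  where c = ballot 1 (suc n) * 1

[k+1]*[n+1]C[k+1]≡[n+1]*nCk : ∀ n k → suc k * (suc n C suc k) ≡ suc n * (n C k)
[k+1]*[n+1]C[k+1]≡[n+1]*nCk n       zero    =
  trans (*-identityˡ _) (trans (nC1≡n (suc n)) (sym (*-identityʳ (suc n))))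
[k+1]*[n+1]C[k+1]≡[n+1]*nCk zero    (suc k) = *-zeroʳ (suc (suc k))
[k+1]*[n+1]C[k+1]≡[n+1]*nCk (suc n) (suc k) = begin
  suc (suc k) * (suc (suc n) C suc (suc k))
    ≡⟨ cong (suc (suc k) *_) (nCk+nC[k+1]≡[n+1]C[k+1] (suc n) (suc k)) ⟨
  suc (suc k) * (A + B)
    ≡⟨ solve 3 (λ k A B → (con 2 :+ k) :* (A :+ B) := A :+ ((con 1 :+ k) :* A :+ (con 2 :+ k) :* B))
               refl k A B ⟩
  A + (suc k * A + suc (suc k) * B)
    ≡⟨ cong (_+_ A) (cong₂ _+_ ([k+1]*[n+1]C[k+1]≡[n+1]*nCk n k)
                                ([k+1]*[n+1]C[k+1]≡[n+1]*nCk n (suc k))) ⟩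
  A + (suc n * (n C k) + suc n * (n C suc k))
    ≡⟨ cong (_+_ A) (trans (cong (suc n *_) (sym (nCk+nC[k+1]≡[n+1]C[k+1] n k)))
                           (*-distribˡ-+ (suc n) (n C k) (n C suc k))) ⟨
  suc (suc n) * A
    ∎
  where
  A = suc n C suc k
  B = suc n C suc (suc k)

m+[1+n]+[1+n]≡2+[m+n+n] : ∀ m n → m + suc n + suc n ≡ suc (suc (m + n + n))
m+[1+n]+[1+n]≡2+[m+n+n] m n = trans (cong (_+ suc n) (+-suc m n)) (cong suc (+-suc (m + n) n))

[2n+1]Cn≡[2n+1]C[n+1] : ∀ n → suc (n + n) C n ≡ suc (n + n) C suc n
[2n+1]Cn≡[2n+1]C[n+1] n =
  trans (nCk≡nC[n∸k] (m≤n+m n (suc n))) (cong (suc (n + n) C_) (m+n∸n≡m (suc n) n))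

[2n+2]C[n+1]≡2*[2n+1]Cn : ∀ n → suc (suc (n + n)) C suc n ≡ 2 * (suc (n + n) C n)
[2n+2]C[n+1]≡2*[2n+1]Cn n = begin
  suc (suc (n + n)) C suc n                  ≡⟨ nCk+nC[k+1]≡[n+1]C[k+1] (suc (n + n)) n ⟨
  R + suc (n + n) C suc n                    ≡⟨ cong (_+_ R) ([2n+1]Cn≡[2n+1]C[n+1] n) ⟨
  R + R                                      ≡⟨ cong (_+_ R) (+-identityʳ R) ⟨
  2 * R                                      ∎
  where R = suc (n + n) C n

-- The reflection principle b(m+1, n) = C(m+2n, n) - C(m+2n, n-1), stated without subtraction
-- using Pascal's rule C(m+2n+1, n) = C(m+2n, n) + C(m+2n, n-1).
mutual
  ballot-formula : ∀ m n → ballot (suc m) n + suc (m + n + n) C n ≡ 2 * ((m + n + n) C n)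
  ballot-formula m zero    = refl
  ballot-formula m (suc n) =
    subst (λ N → ballot (suc m) (suc n) + suc N C suc n ≡ 2 * (N C suc n))
          (sym (m+[1+n]+[1+n]≡2+[m+n+n] m n)) (ballot-formula-suc m n)

  ballot-formula-suc : ∀ m n → ballot (suc m) (suc n) + suc (suc (suc (m + n + n))) C suc n
                                 ≡ 2 * (suc (suc (m + n + n)) C suc n)
  ballot-formula-suc zero n = begin
    ballot 2 n + suc (suc (suc N)) C suc n
      ≡⟨ cong (_+_ (ballot 2 n)) (nCk+nC[k+1]≡[n+1]C[k+1] (suc (suc N)) n) ⟨
    ballot 2 n + (suc (suc N) C n + suc (suc N) C suc n)
      ≡⟨ +-assoc (ballot 2 n) (suc (suc N) C n) T ⟨
    ballot 2 n + suc (suc N) C n + T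
      ≡⟨ cong (_+ T) (ballot-formula 1 n) ⟩
    2 * (suc N C n) + T
      ≡⟨ cong (_+ T) ([2n+2]C[n+1]≡2*[2n+1]Cn n) ⟨
    T + T
      ≡⟨ cong (_+_ T) (+-identityʳ T) ⟨
    2 * (suc (suc N) C suc n)
      ∎
    where
    N = n + n
    T = suc (suc N) C suc n
  ballot-formula-suc (suc j) n = begin
    a + b + suc (suc (suc (suc N))) C suc n
      ≡⟨ cong (_+_ (a + b)) (nCk+nC[k+1]≡[n+1]C[k+1] (suc (suc (suc N))) n) ⟨
    a + b + (x + y)         ≡⟨ cong (_+_ (a + b)) (+-comm x y) ⟩
    a + b + (y + x)         ≡⟨ interchange a b y x ⟩
    (a + y) + (b + x)       ≡⟨ cong₂ _+_ (ballot-formula-suc j n) (ballot-formula (suc (suc j)) n) ⟩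
    2 * u + 2 * v           ≡⟨ *-distribˡ-+ 2 u v ⟨
    2 * (u + v)             ≡⟨ cong (2 *_) (trans (+-comm u v) (nCk+nC[k+1]≡[n+1]C[k+1] (suc (suc N)) n)) ⟩
    2 * y                   ∎
    where
    N = j + n + n
    a = ballot (suc j) (suc n)
    b = ballot (suc (suc (suc j))) n
    x = suc (suc (suc N)) C n
    y = suc (suc (suc N)) C suc n
    u = suc (suc N) C suc n
    v = suc (suc N) C n

ballot1*[1+n]≡[2n]Cn : ∀ n → ballot 1 n * suc n ≡ (n + n) C n
ballot1*[1+n]≡[2n]Cn n = +-cancelʳ-≡ (suc (n + n) * M) _ _ (begin
  B * suc n + suc (n + n) * M  ≡⟨ cong (_+_ (B * suc n)) R*[1+n]≡[2n+1]*M ⟨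
  B * suc n + R * suc n        ≡⟨ *-distribʳ-+ (suc n) B R ⟨
  (B + R) * suc n              ≡⟨ cong (_* suc n) (ballot-formula 0 n) ⟩
  2 * M * suc n                ≡⟨ solve 2 (λ n M → con 2 :* M :* (con 1 :+ n) := M :+ (con 1 :+ (n :+ n)) :* M)
                                          refl n M ⟩
  M + suc (n + n) * M          ∎)
  where
  B = ballot 1 n
  R = suc (n + n) C n
  M = (n + n) C n
  R*[1+n]≡[2n+1]*M : R * suc n ≡ suc (n + n) * M
  R*[1+n]≡[2n+1]*M = begin
    R * suc n                            ≡⟨ *-comm R (suc n) ⟩
    suc n * R                            ≡⟨ cong (suc n *_) ([2n+1]Cn≡[2n+1]C[n+1] n) ⟩
    suc n * (suc (n + n) C suc n)        ≡⟨ [k+1]*[n+1]C[k+1]≡[n+1]*nCk (n + n) n ⟩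
    suc (n + n) * M                      ∎

ballot1≡cat : ∀ n → ballot 1 n ≡ cat n
ballot1≡cat n = begin
  ballot 1 n                       ≡⟨ m*n/n≡m (ballot 1 n) (suc n) ⟨
  ballot 1 n * suc n / suc n       ≡⟨ cong (_/ suc n) (ballot1*[1+n]≡[2n]Cn n) ⟩
  ((n + n) C n) / suc n            ≡⟨ cong (λ m → (m C n) / suc n) (cong (_+_ n) (+-identityʳ n)) ⟨
  cat n                            ∎

-- Polynomials of bounded degree

sumℤ : List ℤ → ℤ
sumℤ = foldr ℤ._+_ (+ 0)

sumℤ-zero : ∀ {xs} → All (_≡ + 0) xs → sumℤ xs ≡ + 0
sumℤ-zero = foldr-preservesᵇ {P = _≡ + 0} {f = ℤ._+_} (λ { refl refl → refl }) refl

sumℤ-applyUpTo-single : ∀ {n j} (f : ℕ → ℤ) → j < n →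
                        (∀ {k} → k < n → k ≢ j → f k ≡ + 0) →
                        sumℤ (applyUpTo f n) ≡ f j
sumℤ-applyUpTo-single {suc n} {zero} f _ others = begin
  f 0 ℤ.+ sumℤ (applyUpTo (f ∘ suc) n)
    ≡⟨ cong (ℤ._+_ (f 0)) (sumℤ-zero (applyUpTo⁺₁ (f ∘ suc) n (λ k<n → others (s≤s k<n) (λ ())))) ⟩
  f 0 ℤ.+ + 0
    ≡⟨ ℤP.+-identityʳ (f 0) ⟩
  f 0
    ∎
sumℤ-applyUpTo-single {suc n} {suc j} f (s≤s j<n) others = begin
  f 0 ℤ.+ sumℤ (applyUpTo (f ∘ suc) n)
    ≡⟨ cong (λ z → z ℤ.+ sumℤ (applyUpTo (f ∘ suc) n)) (others (s≤s z≤n) (λ ())) ⟩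
  + 0 ℤ.+ sumℤ (applyUpTo (f ∘ suc) n)
    ≡⟨ ℤP.+-identityˡ _ ⟩
  sumℤ (applyUpTo (f ∘ suc) n)
    ≡⟨ sumℤ-applyUpTo-single (f ∘ suc) j<n (λ k<n k≢j → others (s≤s k<n) (k≢j ∘ suc-injective)) ⟩
  f (suc j)
    ∎

sumℤ-map-+ : ∀ xs → sumℤ (map +_ xs) ≡ + sum xs
sumℤ-map-+ []       = refl
sumℤ-map-+ (x ∷ xs) = trans (cong (ℤ._+_ (+ x)) (sumℤ-map-+ xs)) (sym (ℤP.pos-+ x (sum xs)))

sumℤ-⋆ : ∀ f g n → sumℤ (map (λ k → + f k ℤ.* + g (n ∸ k)) (upTo (suc n))) ≡ + (f ⋆ g) n
sumℤ-⋆ f g n = begin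
  sumℤ (map (λ k → + f k ℤ.* + g (n ∸ k)) (upTo (suc n)))
    ≡⟨ cong sumℤ (map-cong (λ k → sym (ℤP.pos-* (f k) (g (n ∸ k)))) (upTo (suc n))) ⟩
  sumℤ (map (+_ ∘ (λ k → f k * g (n ∸ k))) (upTo (suc n)))
    ≡⟨ cong sumℤ (map-∘ {g = +_} {f = λ k → f k * g (n ∸ k)} (upTo (suc n))) ⟩
  sumℤ (map +_ (map (λ k → f k * g (n ∸ k)) (upTo (suc n))))
    ≡⟨ sumℤ-map-+ (map (λ k → f k * g (n ∸ k)) (upTo (suc n))) ⟩
  + (f ⋆ g) n
    ∎

HasTopCoeff : Poly → ℕ → ℤ → Set
HasTopCoeff p d c = (p d ≡ c) × (∀ n → d < n → p n ≡ + 0)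

HasTopCoeff-0ₚ : ∀ d → HasTopCoeff 0ₚ d (+ 0)
HasTopCoeff-0ₚ d = refl , λ _ _ → refl

HasTopCoeff-1ₚ : HasTopCoeff 1ₚ 0 (+ 1)
HasTopCoeff-1ₚ = refl , λ { (suc n) _ → refl }

HasTopCoeff-yₚ : HasTopCoeff yₚ 1 (+ 1)
HasTopCoeff-yₚ = refl , λ { (suc zero) (s≤s ()) ; (suc (suc n)) _ → refl }

HasTopCoeff-raise : ∀ {p d c e} → HasTopCoeff p d c → d < e → HasTopCoeff p e (+ 0)
HasTopCoeff-raise (_ , above) d<e = above _ d<e , λ n e<n → above n (<-trans d<e e<n)

HasTopCoeff-+ₚ : ∀ {p q d c c′} → HasTopCoeff p d c → HasTopCoeff q d c′ →
                 HasTopCoeff (p +ₚ q) d (c ℤ.+ c′)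
HasTopCoeff-+ₚ (pd , p-above) (qd , q-above) =
  cong₂ ℤ._+_ pd qd , λ n d<n → cong₂ ℤ._+_ (p-above n d<n) (q-above n d<n)

HasTopCoeff-+ₚ-lowerˡ : ∀ {p q d e c c′} → HasTopCoeff p e c′ → e < d → HasTopCoeff q d c →
                        HasTopCoeff (p +ₚ q) d c
HasTopCoeff-+ₚ-lowerˡ hp e<d hq =
  subst (HasTopCoeff _ _) (ℤP.+-identityˡ _) (HasTopCoeff-+ₚ (HasTopCoeff-raise hp e<d) hq)

HasTopCoeff--ₚ-lowerʳ : ∀ {p q d e c c′} → HasTopCoeff p d c → HasTopCoeff q e c′ → e < d →
                        HasTopCoeff (p -ₚ q) d c
HasTopCoeff--ₚ-lowerʳ {c = c} (pd , p-above) (_ , q-above) e<d =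
  trans (cong₂ ℤ._-_ pd (q-above _ e<d)) (ℤP.+-identityʳ c) ,
  λ n d<n → cong₂ ℤ._-_ (p-above n d<n) (q-above n (<-trans e<d d<n))

HasTopCoeff-sum : ∀ {A : Set} {d} (f : A → Poly) (c : A → ℤ) {xs} →
                  All (λ x → HasTopCoeff (f x) d (c x)) xs →
                  HasTopCoeff (foldr _+ₚ_ 0ₚ (map f xs)) d (sumℤ (map c xs))
HasTopCoeff-sum f c []       = HasTopCoeff-0ₚ _
HasTopCoeff-sum f c (h ∷ hs) = HasTopCoeff-+ₚ h (HasTopCoeff-sum f c hs)

*ₚ-coeff : ∀ p q n → (p *ₚ q) n ≡ sumℤ (applyUpTo (λ k → p k ℤ.* q (n ∸ k)) (suc n))
*ₚ-coeff p q n = cong sumℤ (map-upTo (λ k → p k ℤ.* q (n ∸ k)) (suc n))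

m+n<o⇒n<o∸m : ∀ m n {o} → m + n < o → n < o ∸ m
m+n<o⇒n<o∸m m n {o} m+n<o = m+n≤o⇒m≤o∸n (suc n) (subst (_≤ o) (cong suc (+-comm m n)) m+n<o)

HasTopCoeff-*ₚ : ∀ {p q d e c c′} → HasTopCoeff p d c → HasTopCoeff q e c′ →
                 HasTopCoeff (p *ₚ q) (d + e) (c ℤ.* c′)
HasTopCoeff-*ₚ {p} {q} {d} {e} {c} {c′} (pd , p-above) (qe , q-above) = top , above
  where
  term-vanishes : ∀ {n k} → d < k ⊎ k + e < n → p k ℤ.* q (n ∸ k) ≡ + 0
  term-vanishes {n} {k} (inj₁ d<k)   = cong (ℤ._* q (n ∸ k)) (p-above k d<k)
  term-vanishes {n} {k} (inj₂ k+e<n) =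
    trans (cong (p k ℤ.*_) (q-above (n ∸ k) (m+n<o⇒n<o∸m k e k+e<n))) (ℤP.*-zeroʳ (p k))

  off-diagonal : ∀ {k} → k < suc (d + e) → k ≢ d → p k ℤ.* q (d + e ∸ k) ≡ + 0
  off-diagonal {k} _ k≢d with <-cmp k d
  ... | tri< k<d _ _ = term-vanishes (inj₂ (+-monoˡ-< e k<d))
  ... | tri≈ _ k≡d _ = contradiction k≡d k≢d
  ... | tri> _ _ d<k = term-vanishes (inj₁ d<k)

  top : (p *ₚ q) (d + e) ≡ c ℤ.* c′
  top = begin
    (p *ₚ q) (d + e)
      ≡⟨ *ₚ-coeff p q (d + e) ⟩
    sumℤ (applyUpTo (λ k → p k ℤ.* q (d + e ∸ k)) (suc (d + e)))
      ≡⟨ sumℤ-applyUpTo-single _ (s≤s (m≤m+n d e)) off-diagonal ⟩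
    p d ℤ.* q (d + e ∸ d)
      ≡⟨ cong₂ ℤ._*_ pd (trans (cong q (m+n∸m≡n d e)) qe) ⟩
    c ℤ.* c′
      ∎

  above : ∀ n → d + e < n → (p *ₚ q) n ≡ + 0
  above n d+e<n =
    trans (*ₚ-coeff p q n) (sumℤ-zero (applyUpTo⁺₁ _ (suc n) (λ {k} _ → term-vanishes (split k))))
    where
    split : ∀ k → d < k ⊎ k + e < n
    split k = map₂ (λ k≤d → ≤-<-trans (+-monoˡ-≤ e k≤d) d+e<n) (<-≤-connex d k)

-- The polynomials G_r

G-summand : ℕ → ℕ → Poly
G-summand r i = (Gtab r i -ₚ Gtab r (i ∸ 1)) *ₚ Gtab r (suc r + 1 ∸ i)

G-recurrence : ∀ r → G (suc (suc r)) ≡ 1ₚ +ₚ yₚ +ₚ yₚ *ₚ Σₚ 2 (suc r) (G-summand (suc r))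
G-recurrence r with suc (suc r) ℕ.≟ suc (suc r)
... | yes _  = refl
... | no r≢r = contradiction refl r≢r

Gtab-skip : ∀ {r i} → i ≢ suc r → Gtab (suc r) i ≡ Gtab r i
Gtab-skip {r} {i} i≢1+r with i ℕ.≟ suc r
... | yes i≡1+r = contradiction i≡1+r i≢1+r
... | no _      = refl

Gtab≡G : ∀ {r i} → i ≤ r → Gtab r i ≡ G i
Gtab≡G {zero}  z≤n   = refl
Gtab≡G {suc r} i≤1+r with m≤n⇒m<n∨m≡n i≤1+r
... | inj₂ refl       = refl
... | inj₁ (s≤s i≤r) = trans (Gtab-skip (<⇒≢ (s≤s i≤r))) (Gtab≡G i≤r)

G-summand≡ : ∀ {n k} → k ≤ n →
             G-summand (suc (suc n)) (2 + k) ≡ (G (2 + k) -ₚ G (1 + k)) *ₚ G (2 + (n ∸ k))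
G-summand≡ {n} {k} k≤n = cong₂ _*ₚ_
  (cong₂ _-ₚ_ (Gtab≡G (s≤s (s≤s k≤n))) (Gtab≡G (s≤s (m≤n⇒m≤1+n k≤n))))
  (trans (cong (Gtab (suc (suc n))) index) (Gtab≡G (s≤s (s≤s (m∸n≤m n k)))))
  where
  index : suc (n + 1) ∸ k ≡ 2 + (n ∸ k)
  index = trans (cong (λ m → suc m ∸ k) (+-comm n 1)) (+-∸-assoc 2 k≤n)

GHasTop : ℕ → Set
GHasTop j = HasTopCoeff (G (2 + j)) (1 + (j + j)) (+ ballot 1 j)

HasTopCoeff-1ₚ+ₚyₚ : HasTopCoeff (1ₚ +ₚ yₚ) 1 (+ 1)
HasTopCoeff-1ₚ+ₚyₚ = HasTopCoeff-+ₚ-lowerˡ HasTopCoeff-1ₚ (s≤s z≤n) HasTopCoeff-yₚ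

ΔG-top : ∀ k → (∀ {j} → j ≤ k → GHasTop j) →
         HasTopCoeff (G (2 + k) -ₚ G (1 + k)) (1 + (k + k)) (+ ballot 1 k)
ΔG-top zero    top = HasTopCoeff--ₚ-lowerʳ (top z≤n) HasTopCoeff-1ₚ (s≤s z≤n)
ΔG-top (suc k) top =
  HasTopCoeff--ₚ-lowerʳ (top ≤-refl) (top (n≤1+n k)) (s≤s (s≤s (+-monoʳ-≤ k (n≤1+n k))))

[1+2k]+[1+2[n∸k]]≡2[1+n] : ∀ {n k} → k ≤ n → (1 + (k + k)) + (1 + ((n ∸ k) + (n ∸ k))) ≡ suc n + suc n
[1+2k]+[1+2[n∸k]]≡2[1+n] {n} {k} k≤n = trans
  (solve 2 (λ k t → (con 1 :+ (k :+ k)) :+ (con 1 :+ (t :+ t)) := (con 1 :+ (k :+ t)) :+ (con 1 :+ (k :+ t)))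
           refl k (n ∸ k))
  (cong (λ m → suc m + suc m) (m+[n∸m]≡n k≤n))

G-sum-top : ∀ n → (∀ {j} → j < suc n → GHasTop j) →
            HasTopCoeff (yₚ *ₚ Σₚ 2 (suc (suc n)) (G-summand (suc (suc n))))
                        (1 + (suc n + suc n)) (+ ballot 1 (suc n))
G-sum-top n top =
  subst (HasTopCoeff _ _) catalan-recurrence
    (HasTopCoeff-*ₚ HasTopCoeff-yₚ (HasTopCoeff-sum _ c (applyUpTo⁺₁ id (suc n) summand-top)))
  where
  c : ℕ → ℤ
  c k = + ballot 1 k ℤ.* + ballot 1 (n ∸ k)

  summand-top : ∀ {k} → k < suc n → HasTopCoeff (G-summand (suc (suc n)) (2 + k)) (suc n + suc n) (c k)
  summand-top {k} (s≤s k≤n) =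
    subst₂ (λ p d → HasTopCoeff p d (c k)) (sym (G-summand≡ k≤n)) ([1+2k]+[1+2[n∸k]]≡2[1+n] k≤n)
      (HasTopCoeff-*ₚ (ΔG-top k (λ j≤k → top (s≤s (≤-trans j≤k k≤n)))) (top (s≤s (m∸n≤m n k))))

  catalan-recurrence : + 1 ℤ.* sumℤ (map c (upTo (suc n))) ≡ + ballot 1 (suc n)
  catalan-recurrence = begin
    + 1 ℤ.* sumℤ (map c (upTo (suc n)))  ≡⟨ ℤP.*-identityˡ _ ⟩
    sumℤ (map c (upTo (suc n)))          ≡⟨ sumℤ-⋆ (ballot 1) (ballot 1) n ⟩
    + (ballot 1 ⋆ ballot 1) n            ≡⟨ cong +_ (ballot1⋆ballot 1 n) ⟩
    + ballot 1 (suc n)                   ∎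

G-top : ∀ j → GHasTop j
G-top = <-rec GHasTop step
  where
  step : ∀ n → (∀ {j} → j < n → GHasTop j) → GHasTop n
  step zero    _   =
    HasTopCoeff-+ₚ HasTopCoeff-1ₚ+ₚyₚ (HasTopCoeff-*ₚ HasTopCoeff-yₚ (HasTopCoeff-0ₚ 0))
  step (suc n) top =
    subst (λ p → HasTopCoeff p (1 + (suc n + suc n)) (+ ballot 1 (suc n))) (sym (G-recurrence (suc n)))
    (HasTopCoeff-+ₚ-lowerˡ HasTopCoeff-1ₚ+ₚyₚ (s≤s (s≤s z≤n)) (G-sum-top n top))

2*[2+j]∸3≡1+2j : ∀ j → 2 * (2 + j) ∸ 3 ≡ 1 + (j + j)
2*[2+j]∸3≡1+2j j =
  trans (cong (_∸ 3) (*-distribˡ-+ 2 2 j)) (cong (λ m → suc (j + m)) (+-identityʳ j))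

lemma4p5 : ∀ (r : ℕ) → 2 ≤ r → HasDegreeLead (G r) (2 * r ∸ 3) (+ cat (r ∸ 2))
lemma4p5 (suc zero)    (s≤s ())
lemma4p5 (suc (suc j)) _ =
  cat≢0 ,
  subst₂ (HasTopCoeff (G (2 + j))) (sym (2*[2+j]∸3≡1+2j j)) (cong +_ (ballot1≡cat j)) (G-top j)
  where
  cat≢0 : + cat j ≢ + 0
  cat≢0 eq = <⇒≢ (ballot-suc-positive 0 j) (sym (trans (ballot1≡cat j) (ℤP.+-injective eq)))
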